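{- Let $A$ be an atomic type. Then for all contexts $\Gamma_1,\Gamma_2$ (with disjoint variables), if $[\Gamma_1]\le^s A$ and $[\Gamma_2]\le^s A$, then $[\Gamma_1,\Gamma_2]\le^s A$.
   Context: Simply typed $\lambda$-calculus over base type $0$; every type is uniquely $[A_1,\dots,A_n]:=A_1\to\cdots\to A_n\to0$; $1:=[0]$. A context $\Gamma=x_1^{C_1},\dots,x_k^{C_k}$ is a finite list of distinct typed variables, $\{\Gamma\}$ its variable set, $[\Gamma]:=[C_1,\dots,C_k]$. Terms identified up to $\beta\eta$ ($=_{\beta\eta}$); $\Lambda^\Xi(A)$ = terms of type $A$ with free variables in $\{\Xi\}$. A substitution $\varrho$ from $\Gamma$ to $\Delta$ assigns $\varrho_c\in\Lambda^\Delta(C)$ to each $c^C\in\{\Gamma\}$; for a context $\Xi$ of fresh variables, $\varrho^\Xi$ is $\varrho$ on $\{\Gamma\}$ and the identity on $\{\Xi\}$, and $\hat\varrho^\Xi\colon\Lambda^{\Xi,\Gamma}(0)\to\Lambda^{\Xi,\Delta}(0)$, $M\mapsto M[\Gamma:=\varrho]$. For types, $[\Gamma]\le^s[\Delta]$ means there is a substitution $\varrho$ from $\Gamma$ to $\Delta$ with $\hat\varrho^\Xi$ injective for every fresh context $\Xi$. $\varrho$ is an atomic reduction if for every fresh $\Xi$, all $a^A,b^B\in\{\Xi,\Gamma\}$ with $A\equiv[A_1,\dots,A_n]$, $B\equiv[B_1,\dots,B_m]$, and all $M_i\in\Lambda^{\Xi,\Delta}(A_i)$, $N_i\in\Lambda^{\Xi,\Delta}(B_i)$: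 $\varrho^\Xi_aM_1\cdots M_n=_{\beta\eta}\varrho^\Xi_bN_1\cdots N_m$ implies $a=b$ and all $M_i=N_i$. $[\Gamma]\le^a[\Delta]$ means an atomic reduction from $\Gamma$ to $\Delta$ exists. A type $A$ is atomic if $[1,1]\le^a A$. -}

module Defs where

open import Data.List using (List; []; _∷_; _++_)
open import Data.List.Relation.Unary.All using (All; []; _∷_)
open import Data.Sum using (_⊎_; inj₁; inj₂; [_,_])
open import Data.Product using (Σ)

-- Simple types over the base type 0.
-- Every type is uniquely [A₁,…,Aₙ] := A₁ → ⋯ → Aₙ → 0.

data Ty : Set where
  ⟦_⟧ : List Ty → Ty

o : Ty
o = ⟦ [] ⟧

one : Ty
one = ⟦ o ∷ [] ⟧

-- Contexts: lists of types, in written order (variables are de Bruijn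
-- positions, hence automatically distinct; concatenation Γ ++ Δ is the
-- context Γ,Δ of disjoint variables).  [Γ] is ⟦ Γ ⟧.
Ctx : Set
Ctx = List Ty

infix 4 _∋_
data _∋_ : Ctx → Ty → Set where
  here  : ∀ {Γ A} → (A ∷ Γ) ∋ A
  there : ∀ {Γ A B} → Γ ∋ A → (B ∷ Γ) ∋ A

data Tm (Γ : Ctx) : Ty → Set where
  var : ∀ {A} → Γ ∋ A → Tm Γ A
  lam : ∀ {A As} → Tm (A ∷ Γ) ⟦ As ⟧ → Tm Γ ⟦ A ∷ As ⟧
  app : ∀ {A As} → Tm Γ ⟦ A ∷ As ⟧ → Tm Γ A → Tm Γ ⟦ As ⟧

Ren : Ctx → Ctx → Set
Ren Γ Δ = ∀ {A} → Γ ∋ A → Δ ∋ A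

ext : ∀ {Γ Δ B} → Ren Γ Δ → Ren (B ∷ Γ) (B ∷ Δ)
ext ρ here      = here
ext ρ (there x) = there (ρ x)

rename : ∀ {Γ Δ} → Ren Γ Δ → ∀ {A} → Tm Γ A → Tm Δ A
rename ρ (var x)   = var (ρ x)
rename ρ (lam M)   = lam (rename (ext ρ) M)
rename ρ (app M N) = app (rename ρ M) (rename ρ N)

Subst : Ctx → Ctx → Set
Subst Γ Δ = ∀ {A} → Γ ∋ A → Tm Δ A

exts : ∀ {Γ Δ B} → Subst Γ Δ → Subst (B ∷ Γ) (B ∷ Δ)
exts σ here      = var here
exts σ (there x) = rename there (σ x)

sub : ∀ {Γ Δ} → Subst Γ Δ → ∀ {A} → Tm Γ A → Tm Δ A
sub σ (var x)   = σ x
sub σ (lam M)   = lam (sub (exts σ) M)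
sub σ (app M N) = app (sub σ M) (sub σ N)

sub₀ : ∀ {Γ B} → Tm Γ B → Subst (B ∷ Γ) Γ
sub₀ N here      = N
sub₀ N (there x) = var x

_[_] : ∀ {Γ A B} → Tm (B ∷ Γ) A → Tm Γ B → Tm Γ A
M [ N ] = sub (sub₀ N) M

infix 4 _≈_
data _≈_ {Γ : Ctx} : ∀ {A} → Tm Γ A → Tm Γ A → Set where
  ≈-refl  : ∀ {A} {M : Tm Γ A} → M ≈ M
  ≈-sym   : ∀ {A} {M N : Tm Γ A} → M ≈ N → N ≈ M
  ≈-trans : ∀ {A} {M N P : Tm Γ A} → M ≈ N → N ≈ P → M ≈ P
  ≈-lam   : ∀ {A As} {M N : Tm (A ∷ Γ) ⟦ As ⟧} → M ≈ N → lam M ≈ lam N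
  ≈-app   : ∀ {A As} {M M′ : Tm Γ ⟦ A ∷ As ⟧} {N N′ : Tm Γ A} →
            M ≈ M′ → N ≈ N′ → app M N ≈ app M′ N′
  β       : ∀ {A As} (M : Tm (A ∷ Γ) ⟦ As ⟧) (N : Tm Γ A) →
            app (lam M) N ≈ M [ N ]
  η       : ∀ {A As} (M : Tm Γ ⟦ A ∷ As ⟧) →
            M ≈ lam (app (rename there M) (var here))

inl : ∀ {Γ} Ξ → Ren Ξ (Ξ ++ Γ)
inl (_ ∷ Ξ) here      = here
inl (_ ∷ Ξ) (there x) = there (inl Ξ x)

inr : ∀ {Γ} Ξ → Ren Γ (Ξ ++ Γ)
inr []      x = x
inr (_ ∷ Ξ) x = there (inr Ξ x)

split : ∀ {Γ} Ξ {A} → (Ξ ++ Γ) ∋ A → (Ξ ∋ A) ⊎ (Γ ∋ A)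
split []      x         = inj₂ x
split (_ ∷ Ξ) here      = inj₁ here
split (_ ∷ Ξ) (there x) = [ (λ y → inj₁ (there y)) , inj₂ ] (split Ξ x)

extend : ∀ {Γ Δ} → Subst Γ Δ → ∀ Ξ → Subst (Ξ ++ Γ) (Ξ ++ Δ)
extend ϱ Ξ x = [ (λ y → var (inl Ξ y)) , (λ y → rename (inr Ξ) (ϱ y)) ] (split Ξ x)

hat : ∀ {Γ Δ} → Subst Γ Δ → ∀ Ξ → Tm (Ξ ++ Γ) o → Tm (Ξ ++ Δ) o
hat ϱ Ξ M = sub (extend ϱ Ξ) M

IsInjectiveRed : ∀ {Γ Δ} → Subst Γ Δ → Set
IsInjectiveRed {Γ} ϱ = ∀ Ξ (M N : Tm (Ξ ++ Γ) o) → hat ϱ Ξ M ≈ hat ϱ Ξ N → M ≈ N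

infix 4 _≤ˢ_ _≤ᵃ_
_≤ˢ_ : Ty → Ty → Set
⟦ Γ ⟧ ≤ˢ ⟦ Δ ⟧ = Σ (Subst Γ Δ) IsInjectiveRed

apps : ∀ {Θ As} → Tm Θ ⟦ As ⟧ → All (Tm Θ) As → Tm Θ o
apps h []       = h
apps h (M ∷ Ms) = apps (app h M) Ms

data ArgsEq {Θ : Ctx} : ∀ {As} → All (Tm Θ) As → All (Tm Θ) As → Set where
  []  : ArgsEq [] []
  _∷_ : ∀ {A As} {M N : Tm Θ A} {Ms Ns : All (Tm Θ) As} →
        M ≈ N → ArgsEq Ms Ns → ArgsEq (M ∷ Ms) (N ∷ Ns)

data SameApp {Θ Φ : Ctx} : ∀ {As Bs} → Φ ∋ ⟦ As ⟧ → Φ ∋ ⟦ Bs ⟧ →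
                           All (Tm Θ) As → All (Tm Θ) Bs → Set where
  same : ∀ {As} {a : Φ ∋ ⟦ As ⟧} {Ms Ns : All (Tm Θ) As} →
         ArgsEq Ms Ns → SameApp a a Ms Ns

IsAtomicRed : ∀ {Γ Δ} → Subst Γ Δ → Set
IsAtomicRed {Γ} {Δ} ϱ =
  ∀ Ξ {As Bs} (a : (Ξ ++ Γ) ∋ ⟦ As ⟧) (b : (Ξ ++ Γ) ∋ ⟦ Bs ⟧)
    (Ms : All (Tm (Ξ ++ Δ)) As) (Ns : All (Tm (Ξ ++ Δ)) Bs) →
    apps (extend ϱ Ξ a) Ms ≈ apps (extend ϱ Ξ b) Ns →
    SameApp a b Ms Ns

_≤ᵃ_ : Ty → Ty → Set
⟦ Γ ⟧ ≤ᵃ ⟦ Δ ⟧ = Σ (Subst Γ Δ) IsAtomicRed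

Atomic : Ty → Set
Atomic A = ⟦ one ∷ one ∷ [] ⟧ ≤ᵃ A

-- Let α be an atomic reduction from [1,1] to A = [Δ], and put f := α x₁, g := α x₂. The
-- substitution τ from Δ,Δ to Δ sending a variable d of the first copy to λx̄. g (d x̄) and one of the
-- second copy to λx̄. f (d x̄) is injective: from the τ-image of a β-normal form, atomicity of α
-- recovers the copy each head variable came from, the variable itself and, inductively, its
-- arguments. Hence [Γ₁,Γ₂] ≤ˢ [Γ₁,Δ] ≤ˢ [Δ,Γ₁] ≤ˢ [Δ,Δ] ≤ˢ [Δ], as ≤ˢ is transitive and stable
-- under extending a context on the left and under swapping the two halves of a context.
module Submission where

open import Defs
open import Data.List using (List; []; _∷_; _++_)
open import Data.List.Relation.Unary.All as All using (All; []; _∷_)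
open import Data.Sum using (_⊎_; inj₁; inj₂; [_,_])
import Data.Sum as Sum
open import Data.Sum.Properties using (inj₁-injective; inj₂-injective)
open import Data.Product using (Σ; _,_; _×_)
open import Data.Unit using (⊤; tt)
open import Data.Empty using (⊥; ⊥-elim)
open import Relation.Binary.PropositionalEquality
  using (_≡_; refl; sym; trans; cong; cong₂; subst; subst₂; module ≡-Reasoning)
open import Relation.Binary.Bundles using (Setoid)
import Relation.Binary.Reasoning.Setoid as SetoidReasoning
open import Level using (0ℓ)

-- Renaming and substitution

infix 4 _≗_
_≗_ : ∀ {Γ} {F : Ty → Set} (f g : ∀ {A} → Γ ∋ A → F A) → Set
_≗_ {Γ} f g = ∀ {A} (x : Γ ∋ A) → f x ≡ g x

ren : ∀ {Γ Δ} → Ren Γ Δ → Subst Γ Δ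
ren ρ x = var (ρ x)

infixl 5 _⨾_
_⨾_ : ∀ {Γ Δ Φ} → Subst Γ Δ → Subst Δ Φ → Subst Γ Φ
(σ ⨾ σ′) x = sub σ′ (σ x)

ext-cong : ∀ {Γ Δ B} {ρ ρ′ : Ren Γ Δ} → ρ ≗ ρ′ → ext {B = B} ρ ≗ ext ρ′
ext-cong e here      = refl
ext-cong e (there x) = cong there (e x)

rename-cong : ∀ {Γ Δ} {ρ ρ′ : Ren Γ Δ} → ρ ≗ ρ′ → ∀ {A} (M : Tm Γ A) → rename ρ M ≡ rename ρ′ M
rename-cong e (var x)   = cong var (e x)
rename-cong e (lam M)   = cong lam (rename-cong (ext-cong e) M)
rename-cong e (app M N) = cong₂ app (rename-cong e M) (rename-cong e N)

rename-id : ∀ {Γ} {ρ : Ren Γ Γ} → ρ ≗ (λ x → x) → ∀ {A} (M : Tm Γ A) → rename ρ M ≡ M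
rename-id e (var x)   = cong var (e x)
rename-id e (lam M)   = cong lam (rename-id (λ { here → refl ; (there x) → cong there (e x) }) M)
rename-id e (app M N) = cong₂ app (rename-id e M) (rename-id e N)

rename-rename : ∀ {Γ Δ Φ} (ρ : Ren Γ Δ) (ρ′ : Ren Δ Φ) → ∀ {A} (M : Tm Γ A) →
  rename ρ′ (rename ρ M) ≡ rename (λ x → ρ′ (ρ x)) M
rename-rename ρ ρ′ (var x)   = refl
rename-rename ρ ρ′ (lam M)   = cong lam (trans (rename-rename (ext ρ) (ext ρ′) M)
  (rename-cong (λ { here → refl ; (there x) → refl }) M))
rename-rename ρ ρ′ (app M N) = cong₂ app (rename-rename ρ ρ′ M) (rename-rename ρ ρ′ N)

exts-cong : ∀ {Γ Δ B} {σ σ′ : Subst Γ Δ} → σ ≗ σ′ → exts {B = B} σ ≗ exts σ′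
exts-cong e here      = refl
exts-cong e (there x) = cong (rename there) (e x)

sub-cong : ∀ {Γ Δ} {σ σ′ : Subst Γ Δ} → σ ≗ σ′ → ∀ {A} (M : Tm Γ A) → sub σ M ≡ sub σ′ M
sub-cong e (var x)   = e x
sub-cong e (lam M)   = cong lam (sub-cong (exts-cong e) M)
sub-cong e (app M N) = cong₂ app (sub-cong e M) (sub-cong e N)

sub-var : ∀ {Γ} {σ : Subst Γ Γ} → σ ≗ var → ∀ {A} (M : Tm Γ A) → sub σ M ≡ M
sub-var e (var x)   = e x
sub-var e (lam M)   = cong lam (sub-var (λ { here → refl ; (there x) → cong (rename there) (e x) }) M)
sub-var e (app M N) = cong₂ app (sub-var e M) (sub-var e N)

sub-rename : ∀ {Γ Δ Φ} (ρ : Ren Γ Δ) (σ : Subst Δ Φ) → ∀ {A} (M : Tm Γ A) →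
  sub σ (rename ρ M) ≡ sub (λ x → σ (ρ x)) M
sub-rename ρ σ (var x)   = refl
sub-rename ρ σ (lam M)   = cong lam (trans (sub-rename (ext ρ) (exts σ) M)
  (sub-cong (λ { here → refl ; (there x) → refl }) M))
sub-rename ρ σ (app M N) = cong₂ app (sub-rename ρ σ M) (sub-rename ρ σ N)

rename-sub : ∀ {Γ Δ Φ} (σ : Subst Γ Δ) (ρ : Ren Δ Φ) → ∀ {A} (M : Tm Γ A) →
  rename ρ (sub σ M) ≡ sub (λ x → rename ρ (σ x)) M
rename-sub σ ρ (var x)   = refl
rename-sub σ ρ (lam M)   = cong lam (trans (rename-sub (exts σ) (ext ρ) M)
  (sub-cong (λ { here → refl
               ; (there x) → trans (rename-rename there (ext ρ) (σ x)) (sym (rename-rename ρ there (σ x))) }) M))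
rename-sub σ ρ (app M N) = cong₂ app (rename-sub σ ρ M) (rename-sub σ ρ N)

sub-sub : ∀ {Γ Δ Φ} (σ : Subst Γ Δ) (σ′ : Subst Δ Φ) → ∀ {A} (M : Tm Γ A) →
  sub σ′ (sub σ M) ≡ sub (σ ⨾ σ′) M
sub-sub σ σ′ (var x)   = refl
sub-sub σ σ′ (lam M)   = cong lam (trans (sub-sub (exts σ) (exts σ′) M)
  (sub-cong (λ { here → refl
               ; (there x) → trans (sub-rename there (exts σ′) (σ x)) (sym (rename-sub σ′ there (σ x))) }) M))
sub-sub σ σ′ (app M N) = cong₂ app (sub-sub σ σ′ M) (sub-sub σ σ′ N)

rename-is-sub : ∀ {Γ Δ} (ρ : Ren Γ Δ) → ∀ {A} (M : Tm Γ A) → rename ρ M ≡ sub (ren ρ) M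
rename-is-sub ρ (var x)   = refl
rename-is-sub ρ (lam M)   = cong lam (trans (rename-is-sub (ext ρ) M)
  (sub-cong (λ { here → refl ; (there x) → refl }) M))
rename-is-sub ρ (app M N) = cong₂ app (rename-is-sub ρ M) (rename-is-sub ρ N)

weaken-[] : ∀ {Γ A B} (M : Tm Γ A) (N : Tm Γ B) → rename there M [ N ] ≡ M
weaken-[] M N = trans (sub-rename there _ M) (sub-var (λ _ → refl) M)

sub-[] : ∀ {Γ Δ A B} (σ : Subst Γ Δ) (M : Tm (B ∷ Γ) A) (N : Tm Γ B) →
  sub (exts σ) M [ sub σ N ] ≡ sub σ (M [ N ])
sub-[] σ M N = trans (sub-sub (exts σ) _ M) (trans
  (sub-cong (λ { here → refl ; (there x) → weaken-[] (σ x) (sub σ N) }) M)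
  (sym (sub-sub _ σ M)))

≡⇒≈ : ∀ {Γ A} {M N : Tm Γ A} → M ≡ N → M ≈ N
≡⇒≈ refl = ≈-refl

≈-setoid : Ctx → Ty → Setoid 0ℓ 0ℓ
≈-setoid Γ A = record
  { Carrier       = Tm Γ A
  ; _≈_           = _≈_
  ; isEquivalence = record { refl = ≈-refl ; sym = ≈-sym ; trans = ≈-trans }
  }

sub-≈ : ∀ {Γ Δ} (σ : Subst Γ Δ) → ∀ {A} {M N : Tm Γ A} → M ≈ N → sub σ M ≈ sub σ N
sub-≈ σ ≈-refl        = ≈-refl
sub-≈ σ (≈-sym p)     = ≈-sym (sub-≈ σ p)
sub-≈ σ (≈-trans p q) = ≈-trans (sub-≈ σ p) (sub-≈ σ q)
sub-≈ σ (≈-lam p)     = ≈-lam (sub-≈ (exts σ) p)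
sub-≈ σ (≈-app p q)   = ≈-app (sub-≈ σ p) (sub-≈ σ q)
sub-≈ σ (β M N)       = subst (sub σ (app (lam M) N) ≈_) (sub-[] σ M N) (β _ _)
sub-≈ σ (η M)         = subst (λ X → sub σ M ≈ lam (app X (var here)))
  (trans (rename-sub σ there M) (sym (sub-rename there (exts σ) M))) (η _)

rename-≈ : ∀ {Γ Δ} (ρ : Ren Γ Δ) → ∀ {A} {M N : Tm Γ A} → M ≈ N → rename ρ M ≈ rename ρ N
rename-≈ ρ {M = M} {N} p = subst₂ _≈_ (sym (rename-is-sub ρ M)) (sym (rename-is-sub ρ N)) (sub-≈ (ren ρ) p)

rename-reflects-≈ : ∀ {Γ Δ} (ρ : Ren Γ Δ) (ρ′ : Ren Δ Γ) → (λ x → ρ′ (ρ x)) ≗ (λ x → x) →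
  ∀ {A} {M N : Tm Γ A} → rename ρ M ≈ rename ρ N → M ≈ N
rename-reflects-≈ ρ ρ′ e {M = M} {N} p = subst₂ _≈_
  (trans (rename-rename ρ ρ′ M) (rename-id e M)) (trans (rename-rename ρ ρ′ N) (rename-id e N))
  (rename-≈ ρ′ p)

lam-injective : ∀ {Γ A As} {M N : Tm (A ∷ Γ) ⟦ As ⟧} → lam M ≈ lam N → M ≈ N
lam-injective {M = M} {N} p =
  ≈-trans (≈-sym (η-contract M)) (≈-trans (≈-app (rename-≈ there p) ≈-refl) (η-contract N))
  where
  η-contract : ∀ X → app (rename there (lam X)) (var here) ≈ X
  η-contract X = ≈-trans (β _ _) (≡⇒≈ (trans (sub-rename (ext there) _ X)
    (sub-var (λ { here → refl ; (there x) → refl }) X)))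

sub-apps : ∀ {Γ Δ As} (σ : Subst Γ Δ) (h : Tm Γ ⟦ As ⟧) (Ms : All (Tm Γ) As) →
  sub σ (apps h Ms) ≡ apps (sub σ h) (All.map (sub σ) Ms)
sub-apps σ h []       = refl
sub-apps σ h (M ∷ Ms) = sub-apps σ (app h M) Ms

rename-apps : ∀ {Γ Δ As} (ρ : Ren Γ Δ) (h : Tm Γ ⟦ As ⟧) (Ms : All (Tm Γ) As) →
  rename ρ (apps h Ms) ≡ apps (rename ρ h) (All.map (rename ρ) Ms)
rename-apps ρ h []       = refl
rename-apps ρ h (M ∷ Ms) = rename-apps ρ (app h M) Ms

apps-≈ˡ : ∀ {Γ As} {h h′ : Tm Γ ⟦ As ⟧} (Ms : All (Tm Γ) As) → h ≈ h′ → apps h Ms ≈ apps h′ Ms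
apps-≈ˡ []       p = p
apps-≈ˡ (M ∷ Ms) p = apps-≈ˡ Ms (≈-app p ≈-refl)

apps-≈ʳ : ∀ {Γ As} (h : Tm Γ ⟦ As ⟧) {Ms Ns : All (Tm Γ) As} → ArgsEq Ms Ns → apps h Ms ≈ apps h Ns
apps-≈ʳ h []                       = ≈-refl
apps-≈ʳ h {M ∷ Ms} {N ∷ Ns} (p ∷ ps) = ≈-trans (apps-≈ˡ Ms (≈-app ≈-refl p)) (apps-≈ʳ (app h N) ps)

-- Normalisation by evaluation

data Nf : Ctx → Ty → Set where
  ne  : ∀ {Θ Bs} → Θ ∋ ⟦ Bs ⟧ → All (Nf Θ) Bs → Nf Θ o
  lam : ∀ {Θ A As} → Nf (A ∷ Θ) ⟦ As ⟧ → Nf Θ ⟦ A ∷ As ⟧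

mutual
  ⌜_⌝ : ∀ {Θ A} → Nf Θ A → Tm Θ A
  ⌜ ne h ns ⌝ = apps (var h) ⌜ ns ⌝s
  ⌜ lam n ⌝   = lam ⌜ n ⌝

  ⌜_⌝s : ∀ {Θ As} → All (Nf Θ) As → All (Tm Θ) As
  ⌜ [] ⌝s     = []
  ⌜ n ∷ ns ⌝s = ⌜ n ⌝ ∷ ⌜ ns ⌝s

HasNf : ∀ {Θ A} → Tm Θ A → Set
HasNf {Θ} {A} M = Σ (Nf Θ A) λ n → M ≈ ⌜ n ⌝

HasNf-≈ : ∀ {Θ A} {M M′ : Tm Θ A} → M ≈ M′ → HasNf M → HasNf M′
HasNf-≈ p (n , q) = n , ≈-trans (≈-sym p) q

mutual
  Red : (Θ : Ctx) (As : List Ty) → Tm Θ ⟦ As ⟧ → Set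
  Red Θ As M = ∀ {Θ′} (ρ : Ren Θ Θ′) (Ns : All (Tm Θ′) As) → RedArgs Θ′ As Ns → HasNf (apps (rename ρ M) Ns)

  RedArgs : (Θ : Ctx) (As : List Ty) → All (Tm Θ) As → Set
  RedArgs Θ []             []       = ⊤
  RedArgs Θ (⟦ Bs ⟧ ∷ As) (N ∷ Ns) = Red Θ Bs N × RedArgs Θ As Ns

RedTy : (Θ : Ctx) (A : Ty) → Tm Θ A → Set
RedTy Θ ⟦ As ⟧ = Red Θ As

rename-Red : ∀ {Θ Θ′} A {M : Tm Θ A} (ρ : Ren Θ Θ′) → RedTy Θ A M → RedTy Θ′ A (rename ρ M)
rename-Red ⟦ As ⟧ {M} ρ r ρ′ Ns rs =
  subst (λ X → HasNf (apps X Ns)) (sym (rename-rename ρ ρ′ M)) (r (λ x → ρ′ (ρ x)) Ns rs)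

mutual
  reflect : ∀ {Θ} Bs (x : Θ ∋ ⟦ Bs ⟧) → Red Θ Bs (var x)
  reflect Bs x ρ Ns rs with reifyArgs Bs Ns rs
  ... | ns , ps = ne (ρ x) ns , apps-≈ʳ (var (ρ x)) ps

  reifyArgs : ∀ {Θ} Bs (Ns : All (Tm Θ) Bs) → RedArgs Θ Bs Ns → Σ (All (Nf Θ) Bs) λ ns → ArgsEq Ns ⌜ ns ⌝s
  reifyArgs []             []       tt       = [] , []
  reifyArgs (⟦ Cs ⟧ ∷ Bs) (N ∷ Ns) (r , rs) with reify Cs r | reifyArgs Bs Ns rs
  ... | n , p | ns , ps = n ∷ ns , p ∷ ps

  reify : ∀ {Θ} As {M : Tm Θ ⟦ As ⟧} → Red Θ As M → HasNf M
  reify [] {M} r with r (λ x → x) [] tt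
  ... | n , p = n , subst (_≈ ⌜ n ⌝) (rename-id (λ _ → refl) M) p
  reify (⟦ Cs ⟧ ∷ As) {M} r with reify As {app (rename there M) (var here)} η-expanded
    where
    η-expanded : Red _ As (app (rename there M) (var here))
    η-expanded ρ Ns rs = subst (λ X → HasNf (apps (app X (var (ρ here))) Ns)) (sym (rename-rename there ρ M))
      (r (λ x → ρ (there x)) (var (ρ here) ∷ Ns) (reflect Cs (ρ here) , rs))
  ... | n , p = lam n , ≈-trans (η M) (≈-lam p)

sub-Red : ∀ {Γ Θ A} (M : Tm Γ A) (σ : Subst Γ Θ) → (∀ {B} (x : Γ ∋ B) → RedTy Θ B (σ x)) →
  RedTy Θ A (sub σ M)
sub-Red (var x) σ rσ = rσ x
sub-Red (app {A = ⟦ Bs ⟧} M N) σ rσ ρ Ns rs =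
  sub-Red M σ rσ ρ (rename ρ (sub σ N) ∷ Ns) (rename-Red ⟦ Bs ⟧ ρ (sub-Red N σ rσ) , rs)
sub-Red {Θ = Θ} (lam {A = ⟦ _ ⟧} M) σ rσ {Θ′} ρ (N ∷ Ns) (rN , rs) =
  HasNf-≈ (apps-≈ˡ Ns (≈-sym (≈-trans (β _ _) (≡⇒≈ contract)))) (sub-Red M σ′ rσ′ (λ x → x) Ns rs)
  where
  σ′ : Subst _ Θ′
  σ′ here      = N
  σ′ (there x) = rename ρ (σ x)
  rσ′ : ∀ {B} (x : _ ∋ B) → RedTy Θ′ B (σ′ x)
  rσ′ here          = rN
  rσ′ {B} (there x) = rename-Red B ρ (rσ x)
  contract : rename (ext ρ) (sub (exts σ) M) [ N ] ≡ rename (λ x → x) (sub σ′ M)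
  contract = trans (sub-rename (ext ρ) _ (sub (exts σ) M)) (trans (sub-sub (exts σ) _ M)
    (trans (sub-cong (λ { here → refl
                        ; (there x) → trans (sub-rename there _ (σ x)) (sym (rename-is-sub ρ (σ x))) }) M)
    (sym (rename-id (λ _ → refl) (sub σ′ M)))))

normalise : ∀ {Γ A} (M : Tm Γ A) → HasNf M
normalise {Γ} {⟦ As ⟧} M = reify As (subst (Red Γ As) (sub-var (λ _ → refl) M)
  (sub-Red M var (λ { {⟦ Bs ⟧} x → reflect Bs x })))

split-inl : ∀ {Γ} Ξ {A} (y : Ξ ∋ A) → split {Γ} Ξ (inl Ξ y) ≡ inj₁ y
split-inl     (_ ∷ Ξ) here      = refl
split-inl {Γ} (_ ∷ Ξ) (there y) = cong [ (λ y → inj₁ (there y)) , inj₂ ] (split-inl {Γ} Ξ y)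

split-inr : ∀ {Γ} Ξ {A} (z : Γ ∋ A) → split {Γ} Ξ (inr Ξ z) ≡ inj₂ z
split-inr     []      z = refl
split-inr {Γ} (_ ∷ Ξ) z = cong [ (λ y → inj₁ (there y)) , inj₂ ] (split-inr {Γ} Ξ z)

data View {Γ} (Ξ : Ctx) {A} : (Ξ ++ Γ) ∋ A → Set where
  isL : (y : Ξ ∋ A) → View Ξ (inl Ξ y)
  isR : (z : Γ ∋ A) → View Ξ (inr Ξ z)

view : ∀ {Γ} Ξ {A} (x : (Ξ ++ Γ) ∋ A) → View {Γ} Ξ x
view []      x         = isR x
view (_ ∷ Ξ) here      = isL here
view (_ ∷ Ξ) (there x) with view Ξ x
... | isL y = isL (there y)
... | isR z = isR z

Var : Ctx → Set
Var Φ = Σ Ty (Φ ∋_)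

mapVar : ∀ {Φ Φ′} → Ren Φ Φ′ → Var Φ → Var Φ′
mapVar ρ (A , x) = A , ρ x

splitVar : ∀ {Γ} Ξ → Var (Ξ ++ Γ) → Var Ξ ⊎ Var Γ
splitVar Ξ (A , x) = Sum.map (A ,_) (A ,_) (split Ξ x)

module _ {Γ : Ctx} (Ξ : Ctx) where

  splitVar-inl : ∀ {A} (y : Ξ ∋ A) → splitVar {Γ} Ξ (A , inl Ξ y) ≡ inj₁ (A , y)
  splitVar-inl {A} y = cong (Sum.map (A ,_) (A ,_)) (split-inl Ξ y)

  splitVar-inr : ∀ {A} (z : Γ ∋ A) → splitVar Ξ (A , inr Ξ z) ≡ inj₂ (A , z)
  splitVar-inr {A} z = cong (Sum.map (A ,_) (A ,_)) (split-inr Ξ z)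

  inl-injective : ∀ {A B} {y : Ξ ∋ A} {y′ : Ξ ∋ B} →
    _≡_ {A = Var (Ξ ++ Γ)} (A , inl Ξ y) (B , inl Ξ y′) → _≡_ {A = Var Ξ} (A , y) (B , y′)
  inl-injective {y = y} {y′} e =
    inj₁-injective (trans (sym (splitVar-inl y)) (trans (cong (splitVar Ξ) e) (splitVar-inl y′)))

  inr-injective : ∀ {A B} {z : Γ ∋ A} {z′ : Γ ∋ B} →
    _≡_ {A = Var (Ξ ++ Γ)} (A , inr Ξ z) (B , inr Ξ z′) → _≡_ {A = Var Γ} (A , z) (B , z′)
  inr-injective {z = z} {z′} e =
    inj₂-injective (trans (sym (splitVar-inr z)) (trans (cong (splitVar Ξ) e) (splitVar-inr z′)))

  inl≢inr : ∀ {A B} {y : Ξ ∋ A} {z : Γ ∋ B} → _≡_ {A = Var (Ξ ++ Γ)} (A , inl Ξ y) (B , inr Ξ z) → ⊥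
  inl≢inr {y = y} {z} e with trans (sym (splitVar-inl y)) (trans (cong (splitVar Ξ) e) (splitVar-inr z))
  ... | ()

SameApp⇒≡ : ∀ {Θ Φ As Bs} {a : Φ ∋ ⟦ As ⟧} {b : Φ ∋ ⟦ Bs ⟧} {Ms : All (Tm Θ) As} {Ns : All (Tm Θ) Bs} →
  SameApp a b Ms Ns → _≡_ {A = Var Φ} (⟦ As ⟧ , a) (⟦ Bs ⟧ , b)
SameApp⇒≡ (same _) = refl

SameApp-rehead : ∀ {Θ Φ Φ′ As Bs} {a : Φ ∋ ⟦ As ⟧} {b : Φ ∋ ⟦ Bs ⟧} {a′ : Φ′ ∋ ⟦ As ⟧} {b′ : Φ′ ∋ ⟦ Bs ⟧}
  {Ms : All (Tm Θ) As} {Ns : All (Tm Θ) Bs} →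
  _≡_ {A = Var Φ} (⟦ As ⟧ , a) (⟦ Bs ⟧ , b) → SameApp a′ b′ Ms Ns → SameApp a b Ms Ns
SameApp-rehead refl (same ps) = same ps

extend-inl : ∀ {Γ Δ} (ϱ : Subst Γ Δ) Ξ {A} (y : Ξ ∋ A) → extend ϱ Ξ (inl Ξ y) ≡ var (inl Ξ y)
extend-inl ϱ Ξ y = cong [ (λ y → var (inl Ξ y)) , (λ z → rename (inr Ξ) (ϱ z)) ] (split-inl Ξ y)

extend-inr : ∀ {Γ Δ} (ϱ : Subst Γ Δ) Ξ {A} (z : Γ ∋ A) → extend ϱ Ξ (inr Ξ z) ≡ rename (inr Ξ) (ϱ z)
extend-inr ϱ Ξ z = cong [ (λ y → var (inl Ξ y)) , (λ z → rename (inr Ξ) (ϱ z)) ] (split-inr Ξ z)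

exts-extend : ∀ {Γ Δ} (ϱ : Subst Γ Δ) Ξ C → exts {B = C} (extend ϱ Ξ) ≗ extend ϱ (C ∷ Ξ)
exts-extend ϱ Ξ C x with view (C ∷ Ξ) x
... | isL here      = refl
... | isL (there y) = trans (cong (rename there) (extend-inl ϱ Ξ y)) (sym (extend-inl ϱ (C ∷ Ξ) (there y)))
... | isR z         = trans (cong (rename there) (extend-inr ϱ Ξ z))
                        (trans (rename-rename (inr Ξ) there (ϱ z)) (sym (extend-inr ϱ (C ∷ Ξ) z)))

extend-cong : ∀ {Γ Δ} {ϱ ϱ′ : Subst Γ Δ} → ϱ ≗ ϱ′ → ∀ Ξ → extend ϱ Ξ ≗ extend ϱ′ Ξ
extend-cong {ϱ = ϱ} {ϱ′} e Ξ x with view Ξ x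
... | isL y = trans (extend-inl ϱ Ξ y) (sym (extend-inl ϱ′ Ξ y))
... | isR z = trans (extend-inr ϱ Ξ z) (trans (cong (rename (inr Ξ)) (e z)) (sym (extend-inr ϱ′ Ξ z)))

extend-var : ∀ {Γ} Ξ → extend {Γ} var Ξ ≗ var
extend-var Ξ x with view Ξ x
... | isL y = extend-inl var Ξ y
... | isR z = extend-inr var Ξ z

extend-⨾ : ∀ {Γ Δ Φ} (ϱ : Subst Γ Δ) (σ : Subst Δ Φ) Ξ → extend (ϱ ⨾ σ) Ξ ≗ extend ϱ Ξ ⨾ extend σ Ξ
extend-⨾ ϱ σ Ξ x with view Ξ x
... | isL y = trans (extend-inl (ϱ ⨾ σ) Ξ y)
                (trans (sym (extend-inl σ Ξ y)) (cong (sub (extend σ Ξ)) (sym (extend-inl ϱ Ξ y))))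
... | isR z = trans (extend-inr (ϱ ⨾ σ) Ξ z)
                (trans (rename-sub σ (inr Ξ) (ϱ z))
                (trans (sym (sub-cong (extend-inr σ Ξ) (ϱ z)))
                (trans (sym (sub-rename (inr Ξ) (extend σ Ξ) (ϱ z)))
                       (cong (sub (extend σ Ξ)) (sym (extend-inr ϱ Ξ z))))))

-- Injective reductions

SubInjective : ∀ {Γ Δ} → Subst Γ Δ → Set
SubInjective {Γ} σ = ∀ (M N : Tm Γ o) → sub σ M ≈ sub σ N → M ≈ N

SubInjective-≗ : ∀ {Γ Δ} {σ σ′ : Subst Γ Δ} → σ ≗ σ′ → SubInjective σ → SubInjective σ′
SubInjective-≗ e inj M N p = inj M N (subst₂ _≈_ (sym (sub-cong e M)) (sym (sub-cong e N)) p)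

SubInjective-⨾ : ∀ {Γ Δ Φ} {σ : Subst Γ Δ} {σ′ : Subst Δ Φ} →
  SubInjective σ → SubInjective σ′ → SubInjective (σ ⨾ σ′)
SubInjective-⨾ {σ = σ} {σ′} inj inj′ M N p =
  inj M N (inj′ _ _ (subst₂ _≈_ (sym (sub-sub σ σ′ M)) (sym (sub-sub σ σ′ N)) p))

retraction⇒SubInjective : ∀ {Γ Δ} {σ : Subst Γ Δ} (σ′ : Subst Δ Γ) → σ ⨾ σ′ ≗ var → SubInjective σ
retraction⇒SubInjective {σ = σ} σ′ e M N p = subst₂ _≈_
  (trans (sub-sub σ σ′ M) (sub-var e M)) (trans (sub-sub σ σ′ N) (sub-var e N)) (sub-≈ σ′ p)

renaming⇒SubInjective : ∀ {Γ Δ} (ρ : Ren Γ Δ) (ρ′ : Ren Δ Γ) → (λ x → ρ′ (ρ x)) ≗ (λ x → x) →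
  SubInjective (ren ρ)
renaming⇒SubInjective ρ ρ′ e = retraction⇒SubInjective (ren ρ′) (λ x → cong var (e x))

retraction⇒IsInjectiveRed : ∀ {Γ Δ} {ϱ : Subst Γ Δ} (σ : Subst Δ Γ) → ϱ ⨾ σ ≗ var → IsInjectiveRed ϱ
retraction⇒IsInjectiveRed {ϱ = ϱ} σ e Ξ = retraction⇒SubInjective (extend σ Ξ) λ x →
  trans (sym (extend-⨾ ϱ σ Ξ x)) (trans (extend-cong e Ξ x) (extend-var Ξ x))

≤ˢ-trans : ∀ {A B C} → A ≤ˢ B → B ≤ˢ C → A ≤ˢ C
≤ˢ-trans {⟦ _ ⟧} {⟦ _ ⟧} {⟦ _ ⟧} (ϱ , inj) (σ , inj′) =
  ϱ ⨾ σ , λ Ξ → SubInjective-≗ (λ x → sym (extend-⨾ ϱ σ Ξ x)) (SubInjective-⨾ (inj Ξ) (inj′ Ξ))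

assocʳ : ∀ X Y Z → Ren ((X ++ Y) ++ Z) (X ++ (Y ++ Z))
assocʳ []      Y Z x         = x
assocʳ (_ ∷ X) Y Z here      = here
assocʳ (_ ∷ X) Y Z (there x) = there (assocʳ X Y Z x)

assocˡ : ∀ X Y Z → Ren (X ++ (Y ++ Z)) ((X ++ Y) ++ Z)
assocˡ []      Y Z x         = x
assocˡ (_ ∷ X) Y Z here      = here
assocˡ (_ ∷ X) Y Z (there x) = there (assocˡ X Y Z x)

assocˡ-assocʳ : ∀ X Y Z {A} (x : ((X ++ Y) ++ Z) ∋ A) → assocˡ X Y Z (assocʳ X Y Z x) ≡ x
assocˡ-assocʳ []      Y Z x         = refl
assocˡ-assocʳ (_ ∷ X) Y Z here      = refl
assocˡ-assocʳ (_ ∷ X) Y Z (there x) = cong there (assocˡ-assocʳ X Y Z x)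

assocʳ-assocˡ : ∀ X Y Z {A} (x : (X ++ (Y ++ Z)) ∋ A) → assocʳ X Y Z (assocˡ X Y Z x) ≡ x
assocʳ-assocˡ []      Y Z x         = refl
assocʳ-assocˡ (_ ∷ X) Y Z here      = refl
assocʳ-assocˡ (_ ∷ X) Y Z (there x) = cong there (assocʳ-assocˡ X Y Z x)

assocʳ-inl-inl : ∀ X Y Z {A} (x : X ∋ A) → assocʳ X Y Z (inl (X ++ Y) (inl X x)) ≡ inl X x
assocʳ-inl-inl (_ ∷ X) Y Z here      = refl
assocʳ-inl-inl (_ ∷ X) Y Z (there x) = cong there (assocʳ-inl-inl X Y Z x)

assocʳ-inl-inr : ∀ X Y Z {A} (y : Y ∋ A) → assocʳ X Y Z (inl (X ++ Y) (inr X y)) ≡ inr X (inl Y y)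
assocʳ-inl-inr []      Y Z y = refl
assocʳ-inl-inr (_ ∷ X) Y Z y = cong there (assocʳ-inl-inr X Y Z y)

assocʳ-inr : ∀ X Y Z {A} (z : Z ∋ A) → assocʳ X Y Z (inr (X ++ Y) z) ≡ inr X (inr Y z)
assocʳ-inr []      Y Z z = refl
assocʳ-inr (_ ∷ X) Y Z z = cong there (assocʳ-inr X Y Z z)

extend-extend : ∀ {Γ Δ} (ϱ : Subst Γ Δ) Φ Ξ {A} (x : ((Ξ ++ Φ) ++ Γ) ∋ A) →
  extend (extend ϱ Φ) Ξ (assocʳ Ξ Φ Γ x) ≡ rename (assocʳ Ξ Φ Δ) (extend ϱ (Ξ ++ Φ) x)
extend-extend {Γ} {Δ} ϱ Φ Ξ x with view (Ξ ++ Φ) x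
... | isR z = begin
  extend (extend ϱ Φ) Ξ (assocʳ Ξ Φ Γ (inr (Ξ ++ Φ) z))  ≡⟨ cong (extend (extend ϱ Φ) Ξ) (assocʳ-inr Ξ Φ Γ z) ⟩
  extend (extend ϱ Φ) Ξ (inr Ξ (inr Φ z))                ≡⟨ extend-inr (extend ϱ Φ) Ξ (inr Φ z) ⟩
  rename (inr Ξ) (extend ϱ Φ (inr Φ z))                  ≡⟨ cong (rename (inr Ξ)) (extend-inr ϱ Φ z) ⟩
  rename (inr Ξ) (rename (inr Φ) (ϱ z))                  ≡⟨ rename-rename (inr Φ) (inr Ξ) (ϱ z) ⟩
  rename (λ w → inr Ξ (inr Φ w)) (ϱ z)                   ≡⟨ rename-cong (λ w → sym (assocʳ-inr Ξ Φ Δ w)) (ϱ z) ⟩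
  rename (λ w → assocʳ Ξ Φ Δ (inr (Ξ ++ Φ) w)) (ϱ z)     ≡⟨ rename-rename (inr (Ξ ++ Φ)) (assocʳ Ξ Φ Δ) (ϱ z) ⟨
  rename (assocʳ Ξ Φ Δ) (rename (inr (Ξ ++ Φ)) (ϱ z))    ≡⟨ cong (rename (assocʳ Ξ Φ Δ)) (extend-inr ϱ (Ξ ++ Φ) z) ⟨
  rename (assocʳ Ξ Φ Δ) (extend ϱ (Ξ ++ Φ) (inr (Ξ ++ Φ) z)) ∎
  where open ≡-Reasoning
... | isL w with view Ξ w
...   | isL y = begin
  extend (extend ϱ Φ) Ξ (assocʳ Ξ Φ Γ (inl (Ξ ++ Φ) (inl Ξ y)))  ≡⟨ cong (extend (extend ϱ Φ) Ξ) (assocʳ-inl-inl Ξ Φ Γ y) ⟩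
  extend (extend ϱ Φ) Ξ (inl Ξ y)                                 ≡⟨ extend-inl (extend ϱ Φ) Ξ y ⟩
  var (inl Ξ y)                                                   ≡⟨ cong var (assocʳ-inl-inl Ξ Φ Δ y) ⟨
  rename (assocʳ Ξ Φ Δ) (var (inl (Ξ ++ Φ) (inl Ξ y)))            ≡⟨ cong (rename (assocʳ Ξ Φ Δ)) (extend-inl ϱ (Ξ ++ Φ) (inl Ξ y)) ⟨
  rename (assocʳ Ξ Φ Δ) (extend ϱ (Ξ ++ Φ) (inl (Ξ ++ Φ) (inl Ξ y))) ∎
  where open ≡-Reasoning
...   | isR u = begin
  extend (extend ϱ Φ) Ξ (assocʳ Ξ Φ Γ (inl (Ξ ++ Φ) (inr Ξ u)))  ≡⟨ cong (extend (extend ϱ Φ) Ξ) (assocʳ-inl-inr Ξ Φ Γ u) ⟩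
  extend (extend ϱ Φ) Ξ (inr Ξ (inl Φ u))                         ≡⟨ extend-inr (extend ϱ Φ) Ξ (inl Φ u) ⟩
  rename (inr Ξ) (extend ϱ Φ (inl Φ u))                           ≡⟨ cong (rename (inr Ξ)) (extend-inl ϱ Φ u) ⟩
  var (inr Ξ (inl Φ u))                                           ≡⟨ cong var (assocʳ-inl-inr Ξ Φ Δ u) ⟨
  rename (assocʳ Ξ Φ Δ) (var (inl (Ξ ++ Φ) (inr Ξ u)))            ≡⟨ cong (rename (assocʳ Ξ Φ Δ)) (extend-inl ϱ (Ξ ++ Φ) (inr Ξ u)) ⟨
  rename (assocʳ Ξ Φ Δ) (extend ϱ (Ξ ++ Φ) (inl (Ξ ++ Φ) (inr Ξ u))) ∎
  where open ≡-Reasoning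

≤ˢ-frame : ∀ Φ {Γ Δ} → ⟦ Γ ⟧ ≤ˢ ⟦ Δ ⟧ → ⟦ Φ ++ Γ ⟧ ≤ˢ ⟦ Φ ++ Δ ⟧
≤ˢ-frame Φ {Γ} {Δ} (ϱ , inj) = extend ϱ Φ , λ Ξ →
  SubInjective-≗ (conjugate Ξ)
    (SubInjective-⨾ (SubInjective-⨾ (renaming⇒SubInjective (assocˡ Ξ Φ Γ) (assocʳ Ξ Φ Γ) (assocʳ-assocˡ Ξ Φ Γ))
                                    (inj (Ξ ++ Φ)))
                    (renaming⇒SubInjective (assocʳ Ξ Φ Δ) (assocˡ Ξ Φ Δ) (assocˡ-assocʳ Ξ Φ Δ)))
  where
  conjugate : ∀ Ξ → ren (assocˡ Ξ Φ Γ) ⨾ extend ϱ (Ξ ++ Φ) ⨾ ren (assocʳ Ξ Φ Δ) ≗ extend (extend ϱ Φ) Ξ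
  conjugate Ξ x = begin
    sub (ren (assocʳ Ξ Φ Δ)) (extend ϱ (Ξ ++ Φ) (assocˡ Ξ Φ Γ x))     ≡⟨ rename-is-sub (assocʳ Ξ Φ Δ) _ ⟨
    rename (assocʳ Ξ Φ Δ) (extend ϱ (Ξ ++ Φ) (assocˡ Ξ Φ Γ x))        ≡⟨ extend-extend ϱ Φ Ξ (assocˡ Ξ Φ Γ x) ⟨
    extend (extend ϱ Φ) Ξ (assocʳ Ξ Φ Γ (assocˡ Ξ Φ Γ x))             ≡⟨ cong (extend (extend ϱ Φ) Ξ) (assocʳ-assocˡ Ξ Φ Γ x) ⟩
    extend (extend ϱ Φ) Ξ x                                           ∎
    where open ≡-Reasoning

swap : ∀ Γ Δ → Ren (Γ ++ Δ) (Δ ++ Γ)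
swap Γ Δ x = [ inr Δ , inl Δ ] (split Γ x)

swap-inl : ∀ Γ Δ {A} (y : Γ ∋ A) → swap Γ Δ (inl Γ y) ≡ inr Δ y
swap-inl Γ Δ y = cong [ inr Δ , inl Δ ] (split-inl Γ y)

swap-inr : ∀ Γ Δ {A} (z : Δ ∋ A) → swap Γ Δ (inr Γ z) ≡ inl Δ z
swap-inr Γ Δ z = cong [ inr Δ , inl Δ ] (split-inr Γ z)

swap-swap : ∀ Γ Δ {A} (x : (Γ ++ Δ) ∋ A) → swap Δ Γ (swap Γ Δ x) ≡ x
swap-swap Γ Δ x with view Γ x
... | isL y = trans (cong (swap Δ Γ) (swap-inl Γ Δ y)) (swap-inr Δ Γ y)
... | isR z = trans (cong (swap Δ Γ) (swap-inr Γ Δ z)) (swap-inl Δ Γ z)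

≤ˢ-swap : ∀ Γ Δ → ⟦ Γ ++ Δ ⟧ ≤ˢ ⟦ Δ ++ Γ ⟧
≤ˢ-swap Γ Δ = ren (swap Γ Δ) , retraction⇒IsInjectiveRed (ren (swap Δ Γ)) (λ x → cong var (swap-swap Γ Δ x))

ArgsEq-unrename : ∀ {Γ Δ} (ρ : Ren Γ Δ) (ρ′ : Ren Δ Γ) → (λ x → ρ′ (ρ x)) ≗ (λ x → x) →
  ∀ {As} {Ms Ns : All (Tm Γ) As} → ArgsEq (All.map (rename ρ) Ms) (All.map (rename ρ) Ns) → ArgsEq Ms Ns
ArgsEq-unrename ρ ρ′ e {Ms = []}     {[]}     []       = []
ArgsEq-unrename ρ ρ′ e {Ms = M ∷ Ms} {N ∷ Ns} (p ∷ ps) = rename-reflects-≈ ρ ρ′ e p ∷ ArgsEq-unrename ρ ρ′ e ps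

SameApp-unrename : ∀ {Θ Θ′ Φ} (ρ : Ren Θ Θ′) (ρ′ : Ren Θ′ Θ) → (λ x → ρ′ (ρ x)) ≗ (λ x → x) →
  ∀ {As Bs} {a : Φ ∋ ⟦ As ⟧} {b : Φ ∋ ⟦ Bs ⟧} {Ms Ns} →
  SameApp a b (All.map (rename ρ) Ms) (All.map (rename ρ) Ns) → SameApp a b Ms Ns
SameApp-unrename ρ ρ′ e (same ps) = same (ArgsEq-unrename ρ ρ′ e ps)

-- Renamed into the left part Ξ = Θ ++ Δ of Ξ ++ Γ, on which α^Ξ is the identity, the equation
-- becomes an instance of atomicity; no confluence argument is needed.
atomic⇒var-apps-injective : ∀ {Γ Δ} {α : Subst Γ Δ} → IsAtomicRed α → ∀ Θ {As Bs}
  (a : (Θ ++ Δ) ∋ ⟦ As ⟧) (b : (Θ ++ Δ) ∋ ⟦ Bs ⟧) (Ms : All (Tm (Θ ++ Δ)) As) (Ns : All (Tm (Θ ++ Δ)) Bs) →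
  apps (var a) Ms ≈ apps (var b) Ns → SameApp a b Ms Ns
atomic⇒var-apps-injective {Γ} {Δ} {α} atomic Θ a b Ms Ns p =
  SameApp-unrename (inl Ξ) unl (λ x → cong [ (λ x → x) , inr Θ ] (split-inl Ξ x))
    (SameApp-rehead (inl-injective Ξ (SameApp⇒≡ s)) s)
  where
  Ξ = Θ ++ Δ
  unl : Ren (Ξ ++ Δ) Ξ
  unl x = [ (λ x → x) , inr Θ ] (split Ξ x)
  embed : ∀ {As} (a : Ξ ∋ ⟦ As ⟧) Ms →
    rename (inl Ξ) (apps (var a) Ms) ≡ apps (extend α Ξ (inl Ξ a)) (All.map (rename (inl Ξ)) Ms)
  embed a Ms = trans (rename-apps (inl Ξ) (var a) Ms)
    (cong (λ h → apps h (All.map (rename (inl Ξ)) Ms)) (sym (extend-inl α Ξ a)))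
  s = atomic Ξ (inl Ξ a) (inl Ξ b) _ _ (subst₂ _≈_ (embed a Ms) (embed b Ns) (rename-≈ (inl Ξ) p))

postcompose : ∀ {Θ} Es → Tm Θ one → Tm Θ ⟦ Es ⟧ → Tm Θ ⟦ Es ⟧
postcompose []       F t = app F t
postcompose (E ∷ Es) F t = lam (postcompose Es (rename there F) (app (rename there t) (var here)))

sub-postcompose : ∀ {Γ Δ} Es (σ : Subst Γ Δ) (F : Tm Γ one) (t : Tm Γ ⟦ Es ⟧) →
  sub σ (postcompose Es F t) ≡ postcompose Es (sub σ F) (sub σ t)
sub-postcompose []       σ F t = refl
sub-postcompose (E ∷ Es) σ F t = cong lam (trans (sub-postcompose Es (exts σ) _ _)
  (cong₂ (postcompose Es) (sub-weaken F) (cong₂ app (sub-weaken t) refl)))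
  where
  sub-weaken : ∀ {A} (X : Tm _ A) → sub (exts {B = E} σ) (rename there X) ≡ rename there (sub σ X)
  sub-weaken X = trans (sub-rename there _ X) (sym (rename-sub σ there X))

rename-postcompose : ∀ {Γ Δ} Es (ρ : Ren Γ Δ) (F : Tm Γ one) (t : Tm Γ ⟦ Es ⟧) →
  rename ρ (postcompose Es F t) ≡ postcompose Es (rename ρ F) (rename ρ t)
rename-postcompose Es ρ F t = trans (rename-is-sub ρ (postcompose Es F t)) (trans (sub-postcompose Es _ F t)
  (sym (cong₂ (postcompose Es) (rename-is-sub ρ F) (rename-is-sub ρ t))))

apps-postcompose : ∀ {Γ} Es (F : Tm Γ one) (t : Tm Γ ⟦ Es ⟧) (Ms : All (Tm Γ) Es) →
  apps (postcompose Es F t) Ms ≈ app F (apps t Ms)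
apps-postcompose []       F t []       = ≈-refl
apps-postcompose (E ∷ Es) F t (M ∷ Ms) =
  ≈-trans (apps-≈ˡ Ms (≈-trans (β _ _) (≡⇒≈ (trans (sub-postcompose Es _ _ _)
      (cong₂ (postcompose Es) (weaken-[] F M) (cong₂ app (weaken-[] t M) refl))))))
    (apps-postcompose Es F (app t M) Ms)

module Doubling {Δ} (α : Subst (one ∷ one ∷ []) Δ) (atomic : IsAtomicRed α) where

  f g : Tm Δ one
  f = α here
  g = α (there here)

  postcomposeVar : Tm Δ one → Subst Δ Δ
  postcomposeVar F {⟦ Es ⟧} d = postcompose Es F (var d)

  τ : Subst (Δ ++ Δ) Δ
  τ x = [ postcomposeVar g , postcomposeVar f ] (split Δ x)

  τ^ : ∀ Ξ → Subst (Ξ ++ (Δ ++ Δ)) (Ξ ++ Δ)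
  τ^ = extend τ

  data Block Ξ {A} : (Ξ ++ (Δ ++ Δ)) ∋ A → Set where
    bound  : (y : Ξ ∋ A) → Block Ξ (inl Ξ y)
    first  : (d : Δ ∋ A) → Block Ξ (inr Ξ (inl Δ d))
    second : (d : Δ ∋ A) → Block Ξ (inr Ξ (inr Δ d))

  block : ∀ Ξ {A} (x : (Ξ ++ (Δ ++ Δ)) ∋ A) → Block Ξ x
  block Ξ x with view Ξ x
  ... | isL y = bound y
  ... | isR z with view {Δ} Δ z
  ...   | isL d = first d
  ...   | isR d = second d

  record Image Ξ (M : Tm (Ξ ++ Δ) o) : Set where
    constructor image
    field
      {Cs}  : List Ty
      head  : (Ξ ++ (one ∷ one ∷ [])) ∋ ⟦ Cs ⟧
      args  : All (Tm (Ξ ++ Δ)) Cs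
      ≈head : M ≈ apps (extend α Ξ head) args
  open Image

  agree : ∀ Ξ {M M′} (i : Image Ξ M) (i′ : Image Ξ M′) → M ≈ M′ → SameApp (head i) (head i′) (args i) (args i′)
  agree Ξ i i′ p = atomic Ξ _ _ _ _ (≈-trans (≈-sym (≈head i)) (≈-trans p (≈head i′)))

  image-bound : ∀ Ξ {Bs} (y : Ξ ∋ ⟦ Bs ⟧) Ns → Image Ξ (sub (τ^ Ξ) (apps (var (inl Ξ y)) Ns))
  image-bound Ξ y Ns = image (inl Ξ y) Ms (≡⇒≈ (trans (sub-apps (τ^ Ξ) (var (inl Ξ y)) Ns)
    (cong (λ h → apps h Ms) (trans (extend-inl τ Ξ y) (sym (extend-inl α Ξ y))))))
    where
    Ms = All.map (sub (τ^ Ξ)) Ns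

  image-copy : ∀ Ξ {Bs} (x : (Δ ++ Δ) ∋ ⟦ Bs ⟧) (d : Δ ∋ ⟦ Bs ⟧) (c : (one ∷ one ∷ []) ∋ one) →
    τ x ≡ postcomposeVar (α c) d → ∀ Ns → Image Ξ (sub (τ^ Ξ) (apps (var (inr Ξ x)) Ns))
  image-copy Ξ {Bs} x d c τx Ns = image (inr Ξ c) (apps (var (inr Ξ d)) Ms ∷ []) (begin
    sub (τ^ Ξ) (apps (var (inr Ξ x)) Ns)                             ≡⟨ sub-apps (τ^ Ξ) (var (inr Ξ x)) Ns ⟩
    apps (τ^ Ξ (inr Ξ x)) Ms                                         ≡⟨ cong (λ h → apps h Ms) (extend-inr τ Ξ x) ⟩
    apps (rename (inr Ξ) (τ x)) Ms                                   ≡⟨ cong (λ h → apps (rename (inr Ξ) h) Ms) τx ⟩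
    apps (rename (inr Ξ) (postcompose Bs (α c) (var d))) Ms          ≡⟨ cong (λ h → apps h Ms)
                                                                         (rename-postcompose Bs (inr Ξ) (α c) (var d)) ⟩
    apps (postcompose Bs (rename (inr Ξ) (α c)) (var (inr Ξ d))) Ms  ≈⟨ apps-postcompose Bs _ _ Ms ⟩
    app (rename (inr Ξ) (α c)) (apps (var (inr Ξ d)) Ms)             ≡⟨ cong (λ h → app h (apps (var (inr Ξ d)) Ms))
                                                                         (extend-inr α Ξ c) ⟨
    app (extend α Ξ (inr Ξ c)) (apps (var (inr Ξ d)) Ms)             ∎)
    where
    Ms = All.map (sub (τ^ Ξ)) Ns
    open SetoidReasoning (≈-setoid (Ξ ++ Δ) o)

  image-first : ∀ Ξ {Bs} (d : Δ ∋ ⟦ Bs ⟧) Ns → Image Ξ (sub (τ^ Ξ) (apps (var (inr Ξ (inl Δ d))) Ns))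
  image-first Ξ d = image-copy Ξ (inl Δ d) d (there here)
    (cong [ postcomposeVar g , postcomposeVar f ] (split-inl Δ d))

  image-second : ∀ Ξ {Bs} (d : Δ ∋ ⟦ Bs ⟧) Ns → Image Ξ (sub (τ^ Ξ) (apps (var (inr Ξ (inr Δ d))) Ns))
  image-second Ξ d = image-copy Ξ (inr Δ d) d here
    (cong [ postcomposeVar g , postcomposeVar f ] (split-inr Δ d))

  single-arg : ∀ {Θ Φ} {c c′ : Φ ∋ one} {X Y : Tm Θ o} → SameApp c c′ (X ∷ []) (Y ∷ []) → X ≈ Y
  single-arg (same (p ∷ [])) = p

  same-copy : ∀ Ξ (ι : Ren Δ (Ξ ++ (Δ ++ Δ))) {As Bs} {d : Δ ∋ ⟦ As ⟧} {d′ : Δ ∋ ⟦ Bs ⟧}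
    {c c′ : (Ξ ++ (one ∷ one ∷ [])) ∋ one} {Ms Ms′} →
    SameApp c c′ (apps (var (inr Ξ d)) Ms ∷ []) (apps (var (inr Ξ d′)) Ms′ ∷ []) → SameApp (ι d) (ι d′) Ms Ms′
  same-copy Ξ ι s = SameApp-rehead (cong (mapVar ι) (inr-injective Ξ (SameApp⇒≡ t))) t
    where
    t = atomic⇒var-apps-injective {α = α} atomic Ξ _ _ _ _ (single-arg s)

  g≢f : _≡_ {A = Var (one ∷ one ∷ [])} (one , there here) (one , here) → ⊥
  g≢f ()

  τ^-reflects-heads : ∀ Ξ {As Bs} (h : (Ξ ++ (Δ ++ Δ)) ∋ ⟦ As ⟧) (h′ : (Ξ ++ (Δ ++ Δ)) ∋ ⟦ Bs ⟧) Ns Ns′ →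
    sub (τ^ Ξ) (apps (var h) Ns) ≈ sub (τ^ Ξ) (apps (var h′) Ns′) →
    SameApp h h′ (All.map (sub (τ^ Ξ)) Ns) (All.map (sub (τ^ Ξ)) Ns′)
  τ^-reflects-heads Ξ h h′ Ns Ns′ p with block Ξ h | block Ξ h′
  ... | bound y  | bound y′  = SameApp-rehead (cong (mapVar (inl Ξ)) (inl-injective Ξ (SameApp⇒≡ s))) s
    where s = agree Ξ (image-bound Ξ y Ns) (image-bound Ξ y′ Ns′) p
  ... | first d  | first d′  = same-copy Ξ (λ d → inr Ξ (inl Δ d))
    (agree Ξ (image-first Ξ d Ns) (image-first Ξ d′ Ns′) p)
  ... | second d | second d′ = same-copy Ξ (λ d → inr Ξ (inr Δ d))
    (agree Ξ (image-second Ξ d Ns) (image-second Ξ d′ Ns′) p)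
  ... | bound y  | first d′  = ⊥-elim (inl≢inr Ξ (SameApp⇒≡
    (agree Ξ (image-bound Ξ y Ns) (image-first Ξ d′ Ns′) p)))
  ... | bound y  | second d′ = ⊥-elim (inl≢inr Ξ (SameApp⇒≡
    (agree Ξ (image-bound Ξ y Ns) (image-second Ξ d′ Ns′) p)))
  ... | first d  | bound y′  = ⊥-elim (inl≢inr Ξ (sym (SameApp⇒≡
    (agree Ξ (image-first Ξ d Ns) (image-bound Ξ y′ Ns′) p))))
  ... | second d | bound y′  = ⊥-elim (inl≢inr Ξ (sym (SameApp⇒≡
    (agree Ξ (image-second Ξ d Ns) (image-bound Ξ y′ Ns′) p))))
  ... | first d  | second d′ = ⊥-elim (g≢f (inr-injective Ξ (SameApp⇒≡
    (agree Ξ (image-first Ξ d Ns) (image-second Ξ d′ Ns′) p))))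
  ... | second d | first d′  = ⊥-elim (g≢f (sym (inr-injective Ξ (SameApp⇒≡
    (agree Ξ (image-second Ξ d Ns) (image-first Ξ d′ Ns′) p)))))

  mutual
    τ^-reflects-nf : ∀ Ξ {A} (n m : Nf (Ξ ++ (Δ ++ Δ)) A) → sub (τ^ Ξ) ⌜ n ⌝ ≈ sub (τ^ Ξ) ⌜ m ⌝ → ⌜ n ⌝ ≈ ⌜ m ⌝
    τ^-reflects-nf Ξ (lam {A = C} n) (lam m) p = ≈-lam (τ^-reflects-nf (C ∷ Ξ) n m
      (subst₂ _≈_ (sub-cong (exts-extend τ Ξ C) ⌜ n ⌝) (sub-cong (exts-extend τ Ξ C) ⌜ m ⌝) (lam-injective p)))
    τ^-reflects-nf Ξ (ne h ns) (ne h′ ns′) p with τ^-reflects-heads Ξ h h′ ⌜ ns ⌝s ⌜ ns′ ⌝s p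
    ... | same ps = apps-≈ʳ (var h) (τ^-reflects-nfs Ξ ns ns′ ps)

    τ^-reflects-nfs : ∀ Ξ {Bs} (ns ns′ : All (Nf (Ξ ++ (Δ ++ Δ))) Bs) →
      ArgsEq (All.map (sub (τ^ Ξ)) ⌜ ns ⌝s) (All.map (sub (τ^ Ξ)) ⌜ ns′ ⌝s) → ArgsEq ⌜ ns ⌝s ⌜ ns′ ⌝s
    τ^-reflects-nfs Ξ []       []         []       = []
    τ^-reflects-nfs Ξ (n ∷ ns) (n′ ∷ ns′) (p ∷ ps) = τ^-reflects-nf Ξ n n′ p ∷ τ^-reflects-nfs Ξ ns ns′ ps

  τ-injective : IsInjectiveRed τ
  τ-injective Ξ M N p with normalise M | normalise N
  ... | n , M≈n | m , N≈m = ≈-trans M≈n (≈-trans (τ^-reflects-nf Ξ n m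
    (≈-trans (≈-sym (sub-≈ (τ^ Ξ) M≈n)) (≈-trans p (sub-≈ (τ^ Ξ) N≈m)))) (≈-sym N≈m))

≤ˢ-double : ∀ {Δ} → Atomic ⟦ Δ ⟧ → ⟦ Δ ++ Δ ⟧ ≤ˢ ⟦ Δ ⟧
≤ˢ-double (α , atomic) = Doubling.τ α atomic , Doubling.τ-injective α atomic

corollaryC : (A : Ty) → Atomic A → (Γ₁ Γ₂ : Ctx) →
    ⟦ Γ₁ ⟧ ≤ˢ A → ⟦ Γ₂ ⟧ ≤ˢ A → ⟦ Γ₁ ++ Γ₂ ⟧ ≤ˢ A
corollaryC ⟦ Δ ⟧ atomic Γ₁ Γ₂ Γ₁≤A Γ₂≤A =
  ≤ˢ-trans (≤ˢ-frame Γ₁ Γ₂≤A)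
  (≤ˢ-trans (≤ˢ-swap Γ₁ Δ)
  (≤ˢ-trans (≤ˢ-frame Δ Γ₁≤A)
            (≤ˢ-double atomic)))
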